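{- Let $G=(V,E)$ be a connected Eulerian digraph and $s\in V$, and consider the chip-firing game on $G$ with sink $s$. Let $A$ be an acyclic arc set of $G$ such that $s$ is the unique vertex of in-degree $0$ in $G[A]$. Then the configuration $c$ defined by $c(v)=\mathrm{outdeg}_G(v)-\mathrm{indeg}_{G[A]}(v)$ for every $v\in V\setminus\{s\}$ is recurrent.
   Context: Digraphs are finite and simple; Eulerian means in-degree equals out-degree at every vertex. For $A\subseteq E$, $G[A]$ is the digraph $(V,A)$; $A$ is an acyclic arc set if $G[A]$ has no directed cycle. Chip-firing on $G$ with sink $s$ (i.e. on $G$ with all arcs of tail $s$ deleted): a configuration is a map $c:V\setminus\{s\}\to\mathbb{N}$. A vertex $v\neq s$ is active if $c(v)\ge\mathrm{outdeg}_G(v)\ge1$; firing $v$ subtracts $\mathrm{outdeg}_G(v)$ from $c(v)$ and adds one chip to each out-neighbour $w\ne s$ of $v$ (chips sent to $s$ vanish). Legal firing = firing an active vertex; $c\to^*d$ means $d$ reachable from $c$ by legal firings; $c$ is stable if no vertex is active. $c$ is accessible if for every configuration $d$ there is a configuration $d'$ with $d+d'\to^*c$; $c$ is recurrent if stable and accessible. -}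

module Defs where

open import Data.Nat using (ℕ; zero; suc; _+_; _∸_; _≤_; _<_)
open import Data.Bool using (Bool; true; false; if_then_else_)
open import Data.Fin using (Fin; _≟_)
open import Data.List using (List; map; allFin)
open import Data.Nat.ListAction using (sum)
open import Data.Product using (Σ; ∃; _×_; _,_)
open import Data.Empty using (⊥)
open import Relation.Nullary using (¬_; does)
open import Relation.Binary.PropositionalEquality using (_≡_; _≢_)
open import Relation.Binary.Construct.Closure.ReflexiveTransitive using (Star)

Digraph : ℕ → Set
Digraph n = Fin n → Fin n → Bool

count : ∀ {n} → (Fin n → Bool) → ℕ
count {n} f = sum (map (λ w → if f w then 1 else 0) (allFin n))

outdeg : ∀ {n} → Digraph n → Fin n → ℕ
outdeg E v = count (λ w → E v w)

indeg : ∀ {n} → Digraph n → Fin n → ℕ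
indeg E v = count (λ u → E u v)

-- simple: no loops (multiple arcs are impossible with a Bool relation)
Loopless : ∀ {n} → Digraph n → Set
Loopless E = ∀ v → E v v ≡ false

Eulerian : ∀ {n} → Digraph n → Set
Eulerian E = ∀ v → indeg E v ≡ outdeg E v

data UWalk {n} (E : Digraph n) : Fin n → Fin n → Set where
  here : ∀ {v} → UWalk E v v
  fwd  : ∀ {u v w} → E u v ≡ true → UWalk E v w → UWalk E u w
  bwd  : ∀ {u v w} → E v u ≡ true → UWalk E v w → UWalk E u w

Connected : ∀ {n} → Digraph n → Set
Connected E = ∀ u v → UWalk E u v

-- arc subset A ⊆ E, G[A] = (V, A)
Subgraph : ∀ {n} → Digraph n → Digraph n → Set
Subgraph A E = ∀ u v → A u v ≡ true → E u v ≡ true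

data DPath {n} (A : Digraph n) : Fin n → Fin n → Set where
  arc  : ∀ {u v} → A u v ≡ true → DPath A u v
  cons : ∀ {u v w} → A u v ≡ true → DPath A v w → DPath A u w

Acyclic : ∀ {n} → Digraph n → Set
Acyclic A = ∀ v → ¬ DPath A v v

-- Chip-firing on E with sink s.  Configurations are maps Fin n → ℕ whose
-- value at the sink is ignored (they represent maps V∖{s} → ℕ).

Config : ℕ → Set
Config n = Fin n → ℕ

_⊕_ : ∀ {n} → Config n → Config n → Config n
(c ⊕ d) v = c v + d v

fire : ∀ {n} → Digraph n → Config n → Fin n → Config n
fire E c v w =
  (if does (w ≟ v) then c w ∸ outdeg E v else c w) + (if E v w then 1 else 0)

Active : ∀ {n} → Digraph n → Fin n → Config n → Fin n → Set
Active E s c v = v ≢ s × 1 ≤ outdeg E v × outdeg E v ≤ c v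

Step : ∀ {n} → Digraph n → Fin n → Config n → Config n → Set
Step E s c c' = Σ _ λ v → Active E s c v × c' ≡ fire E c v

_≈[_]_ : ∀ {n} → Config n → Fin n → Config n → Set
c ≈[ s ] d = ∀ v → v ≢ s → c v ≡ d v

Reaches : ∀ {n} → Digraph n → Fin n → Config n → Config n → Set
Reaches E s c d = ∃ λ c' → Star (Step E s) c c' × (c' ≈[ s ] d)

Stable : ∀ {n} → Digraph n → Fin n → Config n → Set
Stable E s c = ∀ v → ¬ Active E s c v

Accessible : ∀ {n} → Digraph n → Fin n → Config n → Set
Accessible E s c = ∀ d → ∃ λ d' → Reaches E s (d ⊕ d') c

Recurrent : ∀ {n} → Digraph n → Fin n → Config n → Set
Recurrent E s c = Stable E s c × Accessible E s c

module Submission where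

-- Stability is immediate: every v ≠ s has an incoming A-arc, so c v < outdeg v.
-- Accessibility is proved by running the game "backwards" with a counter
-- q : V → ℕ recording how often each vertex has fired so far.  A configuration
-- e tracks q if firing every vertex x exactly (K ∸ q x) more times turns e into
-- c; since G is Eulerian, e = c once all counters equal K (CounterFiring).
-- Given d, we build a counter q that decreases steeply along the arcs of A
-- (from a topological numbering of the acyclic set A, AcyclicArcs), so that
-- every vertex receives far more than it needs; this lets us top d up to a
-- configuration tracking q (top-up).  The game can then always continue: a
-- source w (w.r.t. A) of the set of vertices with the lowest counter receives
-- one chip from each A-parent on top of its share, and c w + indeg_A w =
-- outdeg w, so w is active (lowest-source-active).  Firing such vertices
-- until all counters reach K = q s ends in c (reach).

open import Defs
open import Data.Nat using (ℕ; zero; suc; _+_; _*_; _∸_; _^_; _≤_; _<_; z≤n; s≤s; NonZero)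
open import Data.Nat.Properties
  using (≤-refl; ≤-reflexive; ≤-trans; ≤-<-trans; ≤-pred; <-irrefl; <⇒≱; ≤∧≢⇒<; 1+n≰n; n≤1+n;
         n≢0⇒n>0; +-comm; +-assoc; +-identityʳ; *-identityʳ; *-suc; *-distribʳ-+;
         +-mono-≤; +-monoʳ-≤; *-monoʳ-≤; *-monoˡ-≤; +-cancelʳ-≤; +-cancelʳ-≡; m≤m+n; m≤n+m;
         m^n>0; ^-monoʳ-≤; m∸n≤m; ∸-monoʳ-<; +-∸-assoc; m∸n+n≡m; m+[n∸m]≡n; module ≤-Reasoning)
  renaming (_≟_ to _≟ℕ_)
open import Data.Fin using (Fin; zero; suc; _≟_)
open import Data.Fin.Properties using (suc-injective; any?; all?; ¬∀⟶∃¬)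
open import Data.Bool using (Bool; true; false; if_then_else_)
open import Data.Bool.Properties using (¬-not) renaming (_≟_ to _≟B_)
open import Data.List using (map; allFin; tabulate)
open import Data.List.Properties using (map-tabulate)
open import Data.List.Relation.Unary.All using (lookup)
open import Data.List.Membership.Propositional.Properties using (∈-allFin)
open import Data.List.Extrema.Nat using (argmin; f[argmin]≤f[⊤]; f[argmin]≤f[xs])
open import Data.Nat.ListAction using (sum)
open import Data.Product using (∃; ∃₂; _×_; _,_)
open import Data.Empty using (⊥-elim)
open import Function using (id; _∘_)
open import Relation.Nullary using (yes; no; does; Dec)
open import Relation.Nullary.Decidable using (_×-dec_; dec-true)
open import Relation.Binary.PropositionalEquality
  using (_≡_; _≢_; refl; sym; trans; cong; cong₂; subst; subst₂; module ≡-Reasoning)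
open import Relation.Binary.Construct.Closure.ReflexiveTransitive using (Star; ε; _◅_; _◅◅_)

true≢false : true ≢ false
true≢false ()

[_] : Bool → ℕ
[ b ] = if b then 1 else 0

∑ : ∀ {n} → (Fin n → ℕ) → ℕ
∑ {n} f = sum (map f (allFin n))

∑-suc : ∀ {n} (f : Fin (suc n) → ℕ) → ∑ f ≡ f zero + ∑ (f ∘ suc)
∑-suc f = trans (as-tabulate f) (cong (f zero +_) (sym (as-tabulate (f ∘ suc))))
  where
  as-tabulate : ∀ {m} (g : Fin m → ℕ) → ∑ g ≡ sum (tabulate g)
  as-tabulate g = cong sum (map-tabulate id g)

∑-cong : ∀ {n} {f g : Fin n → ℕ} → (∀ x → f x ≡ g x) → ∑ f ≡ ∑ g
∑-cong {zero} h = refl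
∑-cong {suc n} {f} {g} h
  rewrite ∑-suc f | ∑-suc g = cong₂ _+_ (h zero) (∑-cong (h ∘ suc))

∑-mono : ∀ {n} {f g : Fin n → ℕ} → (∀ x → f x ≤ g x) → ∑ f ≤ ∑ g
∑-mono {zero} h = z≤n
∑-mono {suc n} {f} {g} h
  rewrite ∑-suc f | ∑-suc g = +-mono-≤ (h zero) (∑-mono (h ∘ suc))

∑-+ : ∀ {n} (f g : Fin n → ℕ) → ∑ (λ x → f x + g x) ≡ ∑ f + ∑ g
∑-+ {zero} f g = refl
∑-+ {suc n} f g = begin
  ∑ (λ x → f x + g x)                         ≡⟨ ∑-suc (λ x → f x + g x) ⟩
  (f zero + g zero) + ∑ (λ x → f (suc x) + g (suc x))
                                              ≡⟨ cong ((f zero + g zero) +_) (∑-+ (f ∘ suc) (g ∘ suc)) ⟩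
  (f zero + g zero) + (∑ (f ∘ suc) + ∑ (g ∘ suc)) ≡⟨ interchange (f zero) (g zero) _ _ ⟩
  (f zero + ∑ (f ∘ suc)) + (g zero + ∑ (g ∘ suc)) ≡⟨ sym (cong₂ _+_ (∑-suc f) (∑-suc g)) ⟩
  ∑ f + ∑ g                                   ∎
  where
  open ≡-Reasoning
  interchange : ∀ a b c d → (a + b) + (c + d) ≡ (a + c) + (b + d)
  interchange a b c d = begin
    (a + b) + (c + d) ≡⟨ +-assoc a b (c + d) ⟩
    a + (b + (c + d)) ≡⟨ cong (a +_) (sym (+-assoc b c d)) ⟩
    a + ((b + c) + d) ≡⟨ cong (λ z → a + (z + d)) (+-comm b c) ⟩
    a + ((c + b) + d) ≡⟨ cong (a +_) (+-assoc c b d) ⟩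
    a + (c + (b + d)) ≡⟨ sym (+-assoc a c (b + d)) ⟩
    (a + c) + (b + d) ∎

∑-*ʳ : ∀ {n} (f : Fin n → ℕ) k → ∑ (λ x → f x * k) ≡ ∑ f * k
∑-*ʳ {zero} f k = refl
∑-*ʳ {suc n} f k
  rewrite ∑-suc (λ x → f x * k) | ∑-suc f | ∑-*ʳ (f ∘ suc) k =
  sym (*-distribʳ-+ k (f zero) (∑ (f ∘ suc)))

∑-term : ∀ {n} (f : Fin n → ℕ) x → f x ≤ ∑ f
∑-term f zero = ≤-trans (m≤m+n (f zero) _) (≤-reflexive (sym (∑-suc f)))
∑-term f (suc x) =
  ≤-trans (∑-term (f ∘ suc) x) (≤-trans (m≤n+m _ (f zero)) (≤-reflexive (sym (∑-suc f))))

∑-nonzero : ∀ {n} (f : Fin n → ℕ) → ∑ f ≢ 0 → ∃ λ x → f x ≢ 0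
∑-nonzero {zero} f ∑f≢0 = ⊥-elim (∑f≢0 refl)
∑-nonzero {suc n} f ∑f≢0 with f zero ≟ℕ 0
... | no f0≢0 = zero , f0≢0
... | yes f0≡0 with ∑-nonzero (f ∘ suc) (λ rest≡0 → ∑f≢0 (trans (∑-suc f) (cong₂ _+_ f0≡0 rest≡0)))
...   | x , fx≢0 = suc x , fx≢0

∑-update : ∀ {n} (f g : Fin n → ℕ) v a →
  (∀ u → u ≢ v → f u ≡ g u) → f v ≡ g v + a → ∑ f ≡ ∑ g + a
∑-update f g zero a same changed = begin
  ∑ f                             ≡⟨ ∑-suc f ⟩
  f zero + ∑ (f ∘ suc)            ≡⟨ cong₂ _+_ changed (∑-cong (λ u → same (suc u) λ ())) ⟩
  (g zero + a) + ∑ (g ∘ suc)      ≡⟨ +-assoc (g zero) a _ ⟩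
  g zero + (a + ∑ (g ∘ suc))      ≡⟨ cong (g zero +_) (+-comm a _) ⟩
  g zero + (∑ (g ∘ suc) + a)      ≡⟨ sym (+-assoc (g zero) _ a) ⟩
  (g zero + ∑ (g ∘ suc)) + a      ≡⟨ cong (_+ a) (sym (∑-suc g)) ⟩
  ∑ g + a                         ∎
  where open ≡-Reasoning
∑-update f g (suc v) a same changed = begin
  ∑ f                             ≡⟨ ∑-suc f ⟩
  f zero + ∑ (f ∘ suc)            ≡⟨ cong₂ _+_ (same zero λ ())
                                       (∑-update (f ∘ suc) (g ∘ suc) v a
                                          (λ u u≢v → same (suc u) (u≢v ∘ suc-injective)) changed) ⟩
  g zero + (∑ (g ∘ suc) + a)      ≡⟨ sym (+-assoc (g zero) _ a) ⟩
  (g zero + ∑ (g ∘ suc)) + a      ≡⟨ cong (_+ a) (sym (∑-suc g)) ⟩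
  ∑ g + a                         ∎
  where open ≡-Reasoning

∑-select : ∀ {n} (b : Fin n → Bool) K → ∑ (λ u → if b u then K else 0) ≡ count b * K
∑-select b K = trans (∑-cong (λ u → select (b u))) (∑-*ʳ (λ u → [ b u ]) K)
  where
  select : ∀ β → (if β then K else 0) ≡ [ β ] * K
  select true = sym (+-identityʳ K)
  select false = refl

_─_ : ∀ {n} → (Fin n → Bool) → Fin n → Fin n → Bool
(T ─ v) x = if does (x ≟ v) then false else T x

─-keeps : ∀ {n} (T : Fin n → Bool) {v x} → x ≢ v → T x ≡ true → (T ─ v) x ≡ true
─-keeps T {v} {x} x≢v Tx with x ≟ v
... | yes x≡v = ⊥-elim (x≢v x≡v)
... | no _ = Tx

─-⊆ : ∀ {n} (T : Fin n → Bool) {v x} → (T ─ v) x ≡ true → T x ≡ true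
─-⊆ T {v} {x} T'x with x ≟ v
... | yes _ = ⊥-elim (true≢false (sym T'x))
... | no _ = T'x

─-removes : ∀ {n} (T : Fin n → Bool) v → (T ─ v) v ≡ false
─-removes T v with v ≟ v
... | yes _ = refl
... | no v≢v = ⊥-elim (v≢v refl)

count-mono : ∀ {n} {f g : Fin n → Bool} → (∀ x → f x ≡ true → g x ≡ true) → count f ≤ count g
count-mono {f = f} {g} f⊆g = ∑-mono indicator-mono
  where
  indicator-mono : ∀ x → [ f x ] ≤ [ g x ]
  indicator-mono x with f x in fx
  ... | false = z≤n
  ... | true rewrite f⊆g x fx = ≤-refl

count-witness : ∀ {n} (f : Fin n → Bool) → count f ≢ 0 → ∃ λ x → f x ≡ true
count-witness f count≢0 with ∑-nonzero (λ w → [ f w ]) count≢0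
... | x , [fx]≢0 with f x in fx
...   | true = x , fx
...   | false = ⊥-elim ([fx]≢0 refl)

count-─ : ∀ {n} (T : Fin n → Bool) v → T v ≡ true → count T ≡ count (T ─ v) + 1
count-─ T v Tv = ∑-update (λ x → [ T x ]) (λ x → [ (T ─ v) x ]) v 1 same changed
  where
  same : ∀ u → u ≢ v → [ T u ] ≡ [ (T ─ v) u ]
  same u u≢v with u ≟ v
  ... | yes u≡v = ⊥-elim (u≢v u≡v)
  ... | no _ = refl
  changed : [ T v ] ≡ [ (T ─ v) v ] + 1
  changed rewrite ─-removes T v | Tv = refl

count-─≤ : ∀ {n} (T : Fin n → Bool) v k → T v ≡ true → count T ≤ suc k → count (T ─ v) ≤ k
count-─≤ T v k Tv ≤suc rewrite count-─ T v Tv | +-comm (count (T ─ v)) 1 = ≤-pred ≤suc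

count-nonempty : ∀ {n} (T : Fin n → Bool) v → T v ≡ true → 1 ≤ count T
count-nonempty T v Tv rewrite count-─ T v Tv = m≤n+m 1 _

module AcyclicArcs {n} (A : Digraph n) (acyclic : Acyclic A) where

  Walk : Fin n → Fin n → Set
  Walk = Star (λ u v → A u v ≡ true)

  walk-arc : ∀ {w u v} → Walk w u → A u v ≡ true → DPath A w v
  walk-arc ε a = arc a
  walk-arc (a ◅ p) b = cons a (walk-arc p b)

  IsSource : (Fin n → Bool) → Fin n → Set
  IsSource T w = ∀ x → T x ≡ true → A x w ≡ false

  -- Walking backwards inside T from v ends in a source of T; we also record the
  -- walk to v, which is what rules out an arc from v back to the source.
  source-above : ∀ k (T : Fin n → Bool) → count T ≤ k → ∀ v → T v ≡ true →
    ∃ λ w → T w ≡ true × Walk w v × IsSource T w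
  source-above zero T size v Tv = ⊥-elim (1+n≰n (≤-trans (count-nonempty T v Tv) size))
  source-above (suc k) T size v Tv
    with any? (λ x → (T x ≟B true) ×-dec (A x v ≟B true))
  ... | no no-arc = v , Tv , ε , λ x Tx → ¬-not (λ Axv → no-arc (x , Tx , Axv))
  ... | yes (u , Tu , Auv) = step (source-above k (T ─ v) (count-─≤ T v k Tv size) u (─-keeps T u≢v Tu))
    where
    u≢v : u ≢ v
    u≢v refl = acyclic v (arc Auv)
    step : ∃ (λ w → (T ─ v) w ≡ true × Walk w u × IsSource (T ─ v) w) →
           ∃ λ w → T w ≡ true × Walk w v × IsSource T w
    step (w , T'w , w⇝u , source) = w , ─-⊆ T T'w , w⇝u ◅◅ (Auv ◅ ε) , source'
      where
      source' : IsSource T w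
      source' x Tx with x ≟ v
      ... | yes refl = ¬-not (λ Axw → acyclic x (cons Axw (walk-arc w⇝u Auv)))
      ... | no x≢v = source x (─-keeps T x≢v Tx)

  source : ∀ (T : Fin n → Bool) v → T v ≡ true → ∃ λ w → T w ≡ true × IsSource T w
  source T v Tv with source-above (count T) T ≤-refl v Tv
  ... | w , Tw , _ , w-source = w , Tw , w-source

  topological-numbering : ∀ k (T : Fin n → Bool) → count T ≤ k →
    ∃ λ (r : Fin n → ℕ) → (∀ x → r x ≤ k) × (∀ x → T x ≡ false → r x ≡ 0) ×
                          (∀ u v → T v ≡ true → A u v ≡ true → r u < r v)
  topological-numbering k T size with any? (λ x → T x ≟B true)
  ... | no empty = (λ _ → 0) , (λ _ → z≤n) , (λ _ _ → refl) , λ u v Tv _ → ⊥-elim (empty (v , Tv))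
  topological-numbering zero T size | yes (v , Tv) =
    ⊥-elim (1+n≰n (≤-trans (count-nonempty T v Tv) size))
  topological-numbering (suc k) T size | yes (v , Tv) with source T v Tv
  ... | w , Tw , w-source
    with topological-numbering k (T ─ w) (count-─≤ T w k Tw size)
  ... | r' , r'≤k , r'-outside , r'-order = r , bounded , r-outside , order
    where
    r : Fin n → ℕ
    r x = if T x then suc (r' x) else 0
    r-inside : ∀ x → T x ≡ true → r x ≡ suc (r' x)
    r-inside x Tx rewrite Tx = refl
    r-outside : ∀ x → T x ≡ false → r x ≡ 0
    r-outside x Tx rewrite Tx = refl
    bounded : ∀ x → r x ≤ suc k
    bounded x with T x
    ... | true = s≤s (r'≤k x)
    ... | false = z≤n
    order : ∀ u v → T v ≡ true → A u v ≡ true → r u < r v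
    order u v Tv Auv = by-membership (T u) refl
      where
      by-membership : ∀ b → T u ≡ b → r u < r v
      by-membership false Tu = subst₂ _<_ (sym (r-outside u Tu)) (sym (r-inside v Tv)) (s≤s z≤n)
      by-membership true Tu =
        subst₂ _<_ (sym (r-inside u Tu)) (sym (r-inside v Tv)) (s≤s (r'-order u v (─-keeps T v≢w Tv) Auv))
        where
        v≢w : v ≢ w
        v≢w refl = true≢false (trans (sym Auv) (w-source u Tu))

  lowest-source : ∀ (q : Fin n → ℕ) v →
    ∃ λ w → q w ≤ q v × (∀ u → q w ≤ q u) × (∀ u → q u ≡ q w → A u w ≡ false)
  lowest-source q v = lowest (source level v₀ (dec-true (q v₀ ≟ℕ q v₀) refl))
    where
    v₀ : Fin n
    v₀ = argmin q v (allFin n)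
    v₀-minimal : ∀ u → q v₀ ≤ q u
    v₀-minimal u = lookup (f[argmin]≤f[xs] {f = q} v (allFin n)) (∈-allFin u)
    level : Fin n → Bool
    level x = does (q x ≟ℕ q v₀)
    on-level : ∀ x → level x ≡ true → q x ≡ q v₀
    on-level x = sound (q x ≟ℕ q v₀)
      where
      sound : ∀ {P : Set} (P? : Dec P) → does P? ≡ true → P
      sound (yes p) _ = p
      sound (no _) ()
    lowest : (∃ λ w → level w ≡ true × IsSource level w) →
             ∃ λ w → q w ≤ q v × (∀ u → q w ≤ q u) × (∀ u → q u ≡ q w → A u w ≡ false)
    lowest (w , w-level , w-source) = w , below-v , minimal , same-level-source
      where
      qw≡ : q w ≡ q v₀
      qw≡ = on-level w w-level
      below-v : q w ≤ q v
      below-v = subst (_≤ q v) (sym qw≡) (f[argmin]≤f[⊤] {f = q} v (allFin n))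
      minimal : ∀ u → q w ≤ q u
      minimal u = subst (_≤ q u) (sym qw≡) (v₀-minimal u)
      same-level-source : ∀ u → q u ≡ q w → A u w ≡ false
      same-level-source u qu≡qw = w-source u (dec-true (q u ≟ℕ q v₀) (trans qu≡qw qw≡))

-- Chip-firing driven by a counter q : Fin n → ℕ that records how often each
-- vertex has fired.  Fix a target configuration c.
module CounterFiring {n} (E : Digraph n) (s : Fin n)
  (loopless : Loopless E) (eulerian : Eulerian E) (c : Config n) where

  -- Chips that x receives when every u fires q u times.
  inflow : (Fin n → ℕ) → Fin n → ℕ
  inflow q x = ∑ (λ u → if E u x then q u else 0)

  -- e tracks q: e together with the chips x has already emitted equals c plus
  -- what x has received.  When all counters agree, e is c again (Eulerian).
  Tracks : (Fin n → ℕ) → Config n → Set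
  Tracks q e = ∀ x → x ≢ s → e x + outdeg E x * q x ≡ c x + inflow q x

  bump : (Fin n → ℕ) → Fin n → Fin n → ℕ
  bump q v u = if does (u ≟ v) then suc (q u) else q u

  bump-self : ∀ q v → bump q v v ≡ suc (q v)
  bump-self q v with v ≟ v
  ... | yes _ = refl
  ... | no v≢v = ⊥-elim (v≢v refl)

  bump-other : ∀ q {v u} → u ≢ v → bump q v u ≡ q u
  bump-other q {v} {u} u≢v with u ≟ v
  ... | yes u≡v = ⊥-elim (u≢v u≡v)
  ... | no _ = refl

  bump-bounded : ∀ q v {K} → (∀ x → q x ≤ K) → q v < K → ∀ x → bump q v x ≤ K
  bump-bounded q v {K} q≤K qv<K x = by-cases (x ≟ v)
    where
    by-cases : Dec (x ≡ v) → bump q v x ≤ K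
    by-cases (yes refl) = subst (_≤ K) (sym (bump-self q x)) qv<K
    by-cases (no x≢v) = subst (_≤ K) (sym (bump-other q x≢v)) (q≤K x)

  inflow-bump : ∀ q v x → inflow (bump q v) x ≡ inflow q x + [ E v x ]
  inflow-bump q v x = ∑-update _ _ v [ E v x ] unchanged changed
    where
    unchanged : ∀ u → u ≢ v → (if E u x then bump q v u else 0) ≡ (if E u x then q u else 0)
    unchanged u u≢v = cong (λ k → if E u x then k else 0) (bump-other q u≢v)
    changed : (if E v x then bump q v v else 0) ≡ (if E v x then q v else 0) + [ E v x ]
    changed rewrite bump-self q v with E v x
    ... | true = +-comm 1 (q v)
    ... | false = refl

  inflow-≥ : ∀ q {u x} → E u x ≡ true → q u ≤ inflow q x
  inflow-≥ q {u} {x} Eux = subst (λ b → (if b then q u else 0) ≤ inflow q x) Eux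
                              (∑-term (λ u → if E u x then q u else 0) u)

  fire-self : ∀ e v → fire E e v v ≡ e v ∸ outdeg E v
  fire-self e v with v ≟ v
  ... | yes _ rewrite loopless v = +-identityʳ _
  ... | no v≢v = ⊥-elim (v≢v refl)

  fire-other : ∀ e {v x} → x ≢ v → fire E e v x ≡ e x + [ E v x ]
  fire-other e {v} {x} x≢v with x ≟ v
  ... | yes x≡v = ⊥-elim (x≢v x≡v)
  ... | no _ = refl

  fire-tracks-self : ∀ q e v → Tracks q e → outdeg E v ≤ e v → v ≢ s →
    fire E e v v + outdeg E v * bump q v v ≡ c v + inflow (bump q v) v
  fire-tracks-self q e v tracks enough v≢s = begin
    fire E e v v + o * bump q v v    ≡⟨ cong₂ (λ a b → a + o * b) (fire-self e v) (bump-self q v) ⟩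
    (e v ∸ o) + o * suc (q v)        ≡⟨ cong ((e v ∸ o) +_) (*-suc o (q v)) ⟩
    (e v ∸ o) + (o + o * q v)        ≡⟨ sym (+-assoc (e v ∸ o) o _) ⟩
    ((e v ∸ o) + o) + o * q v        ≡⟨ cong (_+ o * q v) (m∸n+n≡m enough) ⟩
    e v + o * q v                    ≡⟨ tracks v v≢s ⟩
    c v + inflow q v                 ≡⟨ cong (c v +_) (sym (+-identityʳ _)) ⟩
    c v + (inflow q v + 0)           ≡⟨ cong (λ b → c v + (inflow q v + [ b ])) (sym (loopless v)) ⟩
    c v + (inflow q v + [ E v v ])   ≡⟨ cong (c v +_) (sym (inflow-bump q v v)) ⟩
    c v + inflow (bump q v) v        ∎
    where
    open ≡-Reasoning
    o = outdeg E v

  fire-tracks-other : ∀ q e v x → Tracks q e → x ≢ v → x ≢ s →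
    fire E e v x + outdeg E x * bump q v x ≡ c x + inflow (bump q v) x
  fire-tracks-other q e v x tracks x≢v x≢s = begin
    fire E e v x + o * bump q v x    ≡⟨ cong₂ (λ a b → a + o * b) (fire-other e x≢v) (bump-other q x≢v) ⟩
    (e x + b) + o * q x              ≡⟨ +-assoc (e x) b _ ⟩
    e x + (b + o * q x)              ≡⟨ cong (e x +_) (+-comm b _) ⟩
    e x + (o * q x + b)              ≡⟨ sym (+-assoc (e x) _ b) ⟩
    (e x + o * q x) + b              ≡⟨ cong (_+ b) (tracks x x≢s) ⟩
    (c x + inflow q x) + b           ≡⟨ +-assoc (c x) _ b ⟩
    c x + (inflow q x + b)           ≡⟨ cong (c x +_) (sym (inflow-bump q v x)) ⟩
    c x + inflow (bump q v) x        ∎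
    where
    open ≡-Reasoning
    o = outdeg E x
    b = [ E v x ]

  fire-tracks : ∀ q e v → Tracks q e → outdeg E v ≤ e v → Tracks (bump q v) (fire E e v)
  fire-tracks q e v tracks enough x x≢s = by-cases (x ≟ v)
    where
    by-cases : Dec (x ≡ v) → fire E e v x + outdeg E x * bump q v x ≡ c x + inflow (bump q v) x
    by-cases (yes refl) = fire-tracks-self q e x tracks enough x≢s
    by-cases (no x≢v) = fire-tracks-other q e v x tracks x≢v x≢s

  tracks-balanced : ∀ q K e → (∀ x → q x ≡ K) → Tracks q e → e ≈[ s ] c
  tracks-balanced q K e balanced tracks x x≢s = +-cancelʳ-≡ (o * K) (e x) (c x) (begin
    e x + o * K                              ≡⟨ cong (λ k → e x + o * k) (sym (balanced x)) ⟩
    e x + o * q x                            ≡⟨ tracks x x≢s ⟩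
    c x + inflow q x                         ≡⟨ cong (c x +_) (∑-cong (λ u → cong (λ k → if E u x then k else 0)
                                                                                  (balanced u))) ⟩
    c x + ∑ (λ u → if E u x then K else 0)   ≡⟨ cong (c x +_) (∑-select (λ u → E u x) K) ⟩
    c x + indeg E x * K                      ≡⟨ cong (λ d → c x + d * K) (eulerian x) ⟩
    c x + o * K                              ∎)
    where
    open ≡-Reasoning
    o = outdeg E x

  top-up : ∀ q (d : Config n) → (∀ x → x ≢ s → outdeg E x * q x + d x ≤ c x + inflow q x) →
    ∃ λ d' → Tracks q (d ⊕ d')
  top-up q d enough = d' , tracks
    where
    d' : Config n
    d' x = (c x + inflow q x) ∸ (outdeg E x * q x + d x)
    tracks : Tracks q (d ⊕ d')
    tracks x x≢s = begin
      (d x + d' x) + o * q x   ≡⟨ +-comm (d x + d' x) _ ⟩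
      o * q x + (d x + d' x)   ≡⟨ sym (+-assoc (o * q x) (d x) _) ⟩
      (o * q x + d x) + d' x   ≡⟨ m+[n∸m]≡n (enough x x≢s) ⟩
      c x + inflow q x         ∎
      where
      open ≡-Reasoning
      o = outdeg E x

  -- How many firings remain until every counter reaches K.
  deficit : ℕ → (Fin n → ℕ) → ℕ
  deficit K q = ∑ (λ x → K ∸ q x)

  deficit-bump : ∀ K q w → q w < K → deficit K q ≡ suc (deficit K (bump q w))
  deficit-bump K q w qw<K = trans (∑-update _ _ w 1 unchanged changed) (+-comm _ 1)
    where
    unchanged : ∀ u → u ≢ w → K ∸ q u ≡ K ∸ bump q w u
    unchanged u u≢w = cong (K ∸_) (sym (bump-other q u≢w))
    changed : K ∸ q w ≡ (K ∸ bump q w w) + 1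
    changed = trans (+-∸-assoc 1 qw<K) (trans (+-comm 1 _) (cong (λ k → (K ∸ k) + 1) (sym (bump-self q w))))

  Progress : ℕ → Set
  Progress K = ∀ q e → q s ≡ K → (∀ x → q x ≤ K) → Tracks q e →
               ∀ v → q v < K → ∃ λ w → Active E s e w × q w < K

  reach : ∀ K → Progress K → ∀ k q e → q s ≡ K → (∀ x → q x ≤ K) → deficit K q ≤ k →
          Tracks q e → Reaches E s e c
  reach K progress k q e qs≡K q≤K deficit≤k tracks with all? (λ x → q x ≟ℕ K)
  ... | yes balanced = e , ε , tracks-balanced q K e balanced tracks
  ... | no unbalanced with ¬∀⟶∃¬ n _ (λ x → q x ≟ℕ K) unbalanced
  ...   | v , qv≢K with progress q e qs≡K q≤K tracks v (≤∧≢⇒< (q≤K v) qv≢K)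
  ...     | w , active@(w≢s , _ , enough) , qw<K = fire-w (subst (_≤ k) (deficit-bump K q w qw<K) deficit≤k)
    where
    fire-w : ∀ {k} → suc (deficit K (bump q w)) ≤ k → Reaches E s e c
    fire-w {suc k'} (s≤s deficit'≤k')
      with reach K progress k' (bump q w) (fire E e w)
             (trans (bump-other q (λ s≡w → w≢s (sym s≡w))) qs≡K) (bump-bounded q w q≤K qw<K) deficit'≤k'
             (fire-tracks q e w tracks enough)
    ... | c' , steps , c'≈c = c' , (w , active , refl) ◅ steps , c'≈c

module Recurrence {n} (E : Digraph n) (s : Fin n) (A : Digraph n)
  (loopless : Loopless E) (eulerian : Eulerian E) (A⊆E : Subgraph A E) (acyclic : Acyclic A)
  (only-s-unentered : ∀ v → indeg A v ≡ 0 → v ≡ s) where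

  open AcyclicArcs A acyclic

  c : Config n
  c v = outdeg E v ∸ indeg A v

  open CounterFiring E s loopless eulerian c

  -- In-degrees in A ⊆ E are bounded by the (Eulerian) out-degree and, away
  -- from s, positive; so c v ∈ [0, outdeg v) for v ≠ s.
  indegA≤outdeg : ∀ v → indeg A v ≤ outdeg E v
  indegA≤outdeg v = subst (indeg A v ≤_) (eulerian v) (count-mono (λ u → A⊆E u v))

  indegA-positive : ∀ v → v ≢ s → 1 ≤ indeg A v
  indegA-positive v v≢s = n≢0⇒n>0 (λ indeg≡0 → v≢s (only-s-unentered v indeg≡0))

  stable : Stable E s c
  stable v (v≢s , _ , outdeg≤c) = <⇒≱ c<outdeg outdeg≤c
    where
    c<outdeg : c v < outdeg E v
    c<outdeg = ∸-monoʳ-< (indegA-positive v v≢s) (indegA≤outdeg v)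

  parent : ∀ v → v ≢ s → ∃ λ u → A u v ≡ true
  parent v v≢s = count-witness (λ u → A u v) (λ indeg≡0 → v≢s (only-s-unentered v indeg≡0))

  non-sinks : Fin n → Bool
  non-sinks = (λ _ → true) ─ s

  steep-counter : ∀ B .{{_ : NonZero B}} → ∃₂ λ (q : Fin n → ℕ) K →
    (∀ x → 1 ≤ q x) × (∀ x → q x ≤ K) × q s ≡ K ×
    (∀ v → v ≢ s → ∃ λ u → A u v ≡ true × B * q v ≤ q u)
  steep-counter B with topological-numbering (count non-sinks) non-sinks ≤-refl
  ... | r , r≤N , r-outside , r-order =
    q , B ^ N , (λ x → m^n>0 B (N ∸ r x)) , (λ x → ^-monoʳ-≤ B (m∸n≤m N (r x))) ,
    cong (λ k → B ^ (N ∸ k)) (r-outside s (─-removes _ s)) , steep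
    where
    N = count non-sinks
    q : Fin n → ℕ
    q x = B ^ (N ∸ r x)
    steep : ∀ v → v ≢ s → ∃ λ u → A u v ≡ true × B * q v ≤ q u
    steep v v≢s with parent v v≢s
    ... | u , Auv = u , Auv , ^-monoʳ-≤ B (∸-monoʳ-< (r-order u v (─-keeps _ v≢s refl) Auv) (r≤N v))

  -- At a source w of the lowest level set of q, the in-neighbours of w have counters
  -- at least q w, and its A-parents strictly more; so w receives enough.
  lowest-source-inflow : ∀ q w → (∀ u → q w ≤ q u) → (∀ u → q u ≡ q w → A u w ≡ false) →
    outdeg E w * q w + indeg A w ≤ inflow q w
  lowest-source-inflow q w lowest w-source = begin
    outdeg E w * m + indeg A w                  ≡⟨ cong (λ k → k * m + indeg A w) (sym (eulerian w)) ⟩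
    indeg E w * m + indeg A w                   ≡⟨ cong (_+ indeg A w) (sym (∑-select (λ u → E u w) m)) ⟩
    ∑ (λ u → if E u w then m else 0) + indeg A w ≡⟨ sym (∑-+ (λ u → if E u w then m else 0) _) ⟩
    ∑ (λ u → (if E u w then m else 0) + [ A u w ]) ≤⟨ ∑-mono per-neighbour ⟩
    inflow q w                                  ∎
    where
    open ≤-Reasoning
    m = q w
    parent-above : ∀ u → A u w ≡ true → m < q u
    parent-above u Auw = ≤∧≢⇒< (lowest u) (λ m≡qu → true≢false (trans (sym Auw) (w-source u (sym m≡qu))))
    per-neighbour : ∀ u → (if E u w then m else 0) + [ A u w ] ≤ (if E u w then q u else 0)
    per-neighbour u with E u w in Euw | A u w in Auw
    ... | true  | true  = subst (_≤ q u) (+-comm 1 m) (parent-above u Auw)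
    ... | true  | false = subst (_≤ q u) (sym (+-identityʳ m)) (lowest u)
    ... | false | true  = ⊥-elim (true≢false (trans (sym (A⊆E u w Auw)) Euw))
    ... | false | false = z≤n

  lowest-source-active : ∀ q e w → Tracks q e → w ≢ s →
    (∀ u → q w ≤ q u) → (∀ u → q u ≡ q w → A u w ≡ false) → Active E s e w
  lowest-source-active q e w tracks w≢s lowest w-source =
    w≢s , ≤-trans (indegA-positive w w≢s) (indegA≤outdeg w) , +-cancelʳ-≤ (o * m) o (e w) enough
    where
    o = outdeg E w
    m = q w
    enough : o + o * m ≤ e w + o * m
    enough = begin
      o + o * m                 ≡⟨ cong (_+ o * m) (sym (m∸n+n≡m (indegA≤outdeg w))) ⟩
      (c w + indeg A w) + o * m ≡⟨ +-assoc (c w) _ _ ⟩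
      c w + (indeg A w + o * m) ≡⟨ cong (c w +_) (+-comm (indeg A w) _) ⟩
      c w + (o * m + indeg A w) ≤⟨ +-monoʳ-≤ (c w) (lowest-source-inflow q w lowest w-source) ⟩
      c w + inflow q w          ≡⟨ sym (tracks w w≢s) ⟩
      e w + o * m               ∎
      where open ≤-Reasoning

  progress : ∀ K → Progress K
  progress K q e qs≡K q≤K tracks v qv<K with lowest-source q v
  ... | w , qw≤qv , lowest , w-source =
    w , lowest-source-active q e w tracks w≢s lowest w-source , qw<K
    where
    qw<K : q w < K
    qw<K = ≤-<-trans qw≤qv qv<K
    w≢s : w ≢ s
    w≢s w≡s = <-irrefl (trans (cong q w≡s) qs≡K) qw<K

  -- A factor exceeding outdeg E v + d v at every vertex v.
  budget : Config n → ℕ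
  budget d = suc (∑ (λ v → outdeg E v + d v))

  steep-room : ∀ d q → (∀ x → 1 ≤ q x) →
    (∀ v → v ≢ s → ∃ λ u → A u v ≡ true × budget d * q v ≤ q u) →
    ∀ x → x ≢ s → outdeg E x * q x + d x ≤ c x + inflow q x
  steep-room d q q≥1 steep x x≢s with steep x x≢s
  ... | u , Aux , Bqx≤qu = begin
    o * q x + d x         ≤⟨ +-monoʳ-≤ (o * q x) d≤dq ⟩
    o * q x + d x * q x   ≡⟨ sym (*-distribʳ-+ (q x) o (d x)) ⟩
    (o + d x) * q x       ≤⟨ *-monoˡ-≤ (q x) (≤-trans (∑-term (λ v → outdeg E v + d v) x) (n≤1+n _)) ⟩
    budget d * q x        ≤⟨ Bqx≤qu ⟩
    q u                   ≤⟨ inflow-≥ q (A⊆E u x Aux) ⟩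
    inflow q x            ≤⟨ m≤n+m _ (c x) ⟩
    c x + inflow q x      ∎
    where
    open ≤-Reasoning
    o = outdeg E x
    d≤dq : d x ≤ d x * q x
    d≤dq = subst (_≤ d x * q x) (*-identityʳ (d x)) (*-monoʳ-≤ (d x) (q≥1 x))

  accessible : Accessible E s c
  accessible d with steep-counter (budget d)
  ... | q , K , q≥1 , q≤K , qs≡K , steep with top-up q d (steep-room d q q≥1 steep)
  ... | d' , tracks = d' , reach K (progress K) (deficit K q) q (d ⊕ d') qs≡K q≤K ≤-refl tracks

lemma10 : ∀ {n} (E : Digraph n) (s : Fin n) (A : Digraph n) →
    Loopless E → Connected E → Eulerian E →
    Subgraph A E → Acyclic A →
    indeg A s ≡ 0 → (∀ v → indeg A v ≡ 0 → v ≡ s) →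
    Recurrent E s (λ v → outdeg E v ∸ indeg A v)
lemma10 E s A loopless _ eulerian A⊆E acyclic _ only-s =
  stable , accessible
  where open Recurrence E s A loopless eulerian A⊆E acyclic only-s
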